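{- Let $\sigma\in\mathcal{G}_n$, let $x$ be a valley of $\sigma$ with $x$-factorization $(w_1,w_2,x,w_4,w_5)$, let $y_1=\min(w_2)$, $y_2=\min(w_4)$ and $y=\min(y_1,y_2)$. Then: (i) if $y$ is a peak of $\sigma$, then $w_4=y$ if $y_1>y_2$, and $w_2=y$ if $y_1<y_2$; (ii) if $y$ is a double ascent of $\sigma$, then $w_4=yw_4''$ with $w_4''$ nonempty if $y_1>y_2$, and $w_2=yw_2''$ with $w_2''$ nonempty if $y_1<y_2$; (iii) if $y$ is a valley of $\sigma$, then $w_4=w_4'yw_4''$ with $w_4',w_4''$ nonempty if $y_1>y_2$, and $w_2=w_2'yw_2''$ with $w_2',w_2''$ nonempty if $y_1<y_2$.
   Context: For a permutation $\sigma=\sigma_1\cdots\sigma_n$ of $[n]$ set $\sigma_0=\sigma_{n+1}=0$; $\sigma_i$ ($1\le i\le n$) is a peak if $\sigma_{i-1}<\sigma_i>\sigma_{i+1}$, a valley if $\sigma_{i-1}>\sigma_i<\sigma_{i+1}$, a double ascent if $\sigma_{i-1}<\sigma_i<\sigma_{i+1}$, a double descent if $\sigma_{i-1}>\sigma_i>\sigma_{i+1}$. $\mathcal{G}_n$ is the set of permutations of $[n]$ without double descents. Words are sequences of distinct positive integers, juxtaposition is concatenation, $\epsilon$ is the empty word. For a letter $x$ of $\sigma$, the $x$-factorization of $\sigma$ is the unique factorization $\sigma=w_1w_2xw_4w_5$ (words possibly empty) such that: $w_1$ is empty or its last letter is less than $x$; all letters of $w_2$ and of $w_4$ are greater than $x$;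 $w_5$ is empty or its first letter is less than $x$. For a valley $x$ both $w_2$ and $w_4$ are nonempty. -}

module Defs where

open import Data.Nat using (ℕ; zero; suc; _<_; _≤_; _>_)
open import Data.List using (List; []; _∷_; _++_; [_]; map; upTo)
open import Data.List.Relation.Unary.All using (All)
open import Data.List.Membership.Propositional using (_∈_)
open import Data.List.Relation.Binary.Permutation.Propositional using (_↭_)
open import Data.Product using (_×_; ∃-syntax)
open import Data.Sum using (_⊎_)
open import Relation.Binary.PropositionalEquality using (_≡_)
open import Relation.Nullary using (¬_)

IsPerm : ℕ → List ℕ → Set
IsPerm n σ = σ ↭ map suc (upTo n)

-- last letter of a word, with the sentinel σ₀ = 0 for the empty word
lastOr0 : List ℕ → ℕ
lastOr0 []           = 0
lastOr0 (a ∷ [])     = a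
lastOr0 (a ∷ b ∷ w)  = lastOr0 (b ∷ w)

-- first letter of a word, with the sentinel σ_{n+1} = 0 for the empty word
headOr0 : List ℕ → ℕ
headOr0 []      = 0
headOr0 (a ∷ _) = a

Peak : List ℕ → ℕ → Set
Peak σ x = ∃[ u ] ∃[ v ] (σ ≡ u ++ x ∷ v × lastOr0 u < x × headOr0 v < x)

Valley : List ℕ → ℕ → Set
Valley σ x = ∃[ u ] ∃[ v ] (σ ≡ u ++ x ∷ v × lastOr0 u > x × headOr0 v > x)

DoubleAscent : List ℕ → ℕ → Set
DoubleAscent σ x = ∃[ u ] ∃[ v ] (σ ≡ u ++ x ∷ v × lastOr0 u < x × x < headOr0 v)

DoubleDescent : List ℕ → ℕ → Set
DoubleDescent σ x = ∃[ u ] ∃[ v ] (σ ≡ u ++ x ∷ v × lastOr0 u > x × x > headOr0 v)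

InG : ℕ → List ℕ → Set
InG n σ = IsPerm n σ × (∀ x → ¬ DoubleDescent σ x)

LastLess : List ℕ → ℕ → Set
LastLess w x = w ≡ [] ⊎ ∃[ u ] ∃[ z ] (w ≡ u ++ [ z ] × z < x)

FirstLess : List ℕ → ℕ → Set
FirstLess w x = w ≡ [] ⊎ ∃[ z ] ∃[ u ] (w ≡ z ∷ u × z < x)

XFactorization : List ℕ → ℕ → List ℕ → List ℕ → List ℕ → List ℕ → Set
XFactorization σ x w₁ w₂ w₄ w₅ =
  σ ≡ w₁ ++ w₂ ++ x ∷ w₄ ++ w₅
  × LastLess w₁ x
  × All (x <_) w₂
  × All (x <_) w₄
  × FirstLess w₅ x

IsMin : ℕ → List ℕ → Set
IsMin y w = y ∈ w × All (y ≤_) w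

module Submission where

open import Defs
open import Data.Nat using (ℕ; _<_; _>_; _≤_; _⊓_; suc; z≤n; s≤s)
open import Data.Nat.Properties using (<⇒≤; <-trans; <-irrefl; ≤⇒≯; suc-injective; m≥n⇒m⊓n≡n; m≤n⇒m⊓n≡m)
open import Data.List using (List; []; _∷_; _++_; [_])
open import Data.List.Properties using (∷-injective; ++-assoc; ++-identityʳ)
open import Data.List.Relation.Unary.All as All using (All)
open import Data.List.Relation.Unary.All.Properties using (++⁻ˡ; ++⁻ʳ)
open import Data.List.Relation.Unary.AllPairs using (_∷_)
open import Data.List.Relation.Unary.Unique.Propositional using (Unique)
import Data.List.Relation.Unary.Unique.Propositional.Properties as Unique
open import Data.List.Relation.Binary.Permutation.Propositional using (↭-sym; ↭⇒↭ₛ)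
open import Data.List.Relation.Binary.Permutation.Setoid.Properties using (Unique-resp-↭)
open import Data.List.Membership.Propositional.Properties using (∈-∃++; ∈-insert)
open import Data.Product using (_×_; _,_; ∃-syntax)
open import Data.Sum using (inj₁; inj₂)
open import Data.Empty using (⊥-elim)
open import Relation.Binary.PropositionalEquality
  using (_≡_; _≢_; refl; sym; trans; cong; subst; setoid; module ≡-Reasoning)

-- If y is the minimum of
-- a factor w of σ whose outer neighbours are both smaller than y, then the
-- neighbours of y inside w are larger than y and those outside w are smaller,
-- so the type of y (peak, double ascent, valley) says exactly on which sides
-- y has neighbours inside w.  Both w₂ and w₄ are framed by letters below x,
-- and x is below every letter of w₂ and w₄.

IsPerm⇒Unique : ∀ n {σ} → IsPerm n σ → Unique σ
IsPerm⇒Unique n σ↭ =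
  Unique-resp-↭ (setoid ℕ) (↭⇒↭ₛ (↭-sym σ↭)) (Unique.map⁺ suc-injective (Unique.upTo⁺ n))

Unique-++-∷-cancel : ∀ {y : ℕ} u v {u′ v′} → Unique (u ++ y ∷ v) →
                     u ++ y ∷ v ≡ u′ ++ y ∷ v′ → u ≡ u′ × v ≡ v′
Unique-++-∷-cancel []      v {[]}     _        refl = refl , refl
Unique-++-∷-cancel []      v {a ∷ u′} (y∉ ∷ _) refl = ⊥-elim (All.lookup y∉ (∈-insert u′) refl)
Unique-++-∷-cancel (a ∷ u) v {[]}     (y∉ ∷ _) refl = ⊥-elim (All.lookup y∉ (∈-insert u) refl)
Unique-++-∷-cancel (a ∷ u) v {b ∷ u′} (_ ∷ uq) eq with ∷-injective eq
... | refl , eq′ with Unique-++-∷-cancel u v uq eq′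
...   | refl , refl = refl , refl

lastOr0-++-∷ : ∀ u (z : ℕ) v → lastOr0 (u ++ z ∷ v) ≡ lastOr0 (z ∷ v)
lastOr0-++-∷ []           z v = refl
lastOr0-++-∷ (a ∷ [])     z v = refl
lastOr0-++-∷ (a ∷ b ∷ u)  z v = lastOr0-++-∷ (b ∷ u) z v

lastOr0-++-[] : ∀ u (z : ℕ) → lastOr0 (u ++ [ z ]) ≡ z
lastOr0-++-[] u z = lastOr0-++-∷ u z []

All-≤-lastOr0 : ∀ {y} z v → All (y ≤_) (z ∷ v) → y ≤ lastOr0 (z ∷ v)
All-≤-lastOr0 z []      (y≤z All.∷ _) = y≤z
All-≤-lastOr0 z (b ∷ v) (_ All.∷ y≤v) = All-≤-lastOr0 b v y≤v

lastOr0-++-<⇒≡[] : ∀ {y} u a → All (y ≤_) a → lastOr0 (u ++ a) < y → a ≡ []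
lastOr0-++-<⇒≡[] u []      _   _   = refl
lastOr0-++-<⇒≡[] u (z ∷ a) y≤a last<y rewrite lastOr0-++-∷ u z a =
  ⊥-elim (≤⇒≯ (All-≤-lastOr0 z a y≤a) last<y)

headOr0-++-<⇒≡[] : ∀ {y} b v → All (y ≤_) b → headOr0 (b ++ v) < y → b ≡ []
headOr0-++-<⇒≡[] []      v _               _      = refl
headOr0-++-<⇒≡[] (z ∷ b) v (y≤z All.∷ _) head<y = ⊥-elim (≤⇒≯ y≤z head<y)

LastLess⇒lastOr0< : ∀ {x y} w → LastLess w x → x < y → lastOr0 w < y
LastLess⇒lastOr0< {y = suc _} w (inj₁ refl) _ = s≤s z≤n
LastLess⇒lastOr0< w (inj₂ (u , z , refl , z<x)) x<y rewrite lastOr0-++-[] u z = <-trans z<x x<y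

FirstLess⇒headOr0< : ∀ {x y} w → FirstLess w x → x < y → headOr0 w < y
FirstLess⇒headOr0< {y = suc _} w (inj₁ refl) _ = s≤s z≤n
FirstLess⇒headOr0< w (inj₂ (z , u , refl , z<x)) x<y = <-trans z<x x<y

record MinShape (σ : List ℕ) (y : ℕ) (w : List ℕ) : Set where
  field
    peak         : Peak σ y → w ≡ [ y ]
    doubleAscent : DoubleAscent σ y → ∃[ w″ ] (w″ ≢ [] × w ≡ y ∷ w″)
    valley       : Valley σ y → ∃[ w′ ] ∃[ w″ ] (w′ ≢ [] × w″ ≢ [] × w ≡ w′ ++ y ∷ w″)

framed-min-shape : ∀ {σ y} P w S → Unique σ → σ ≡ P ++ w ++ S → IsMin y w →
                   lastOr0 P < y → headOr0 S < y → MinShape σ y w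
framed-min-shape {σ} {y} P w S uσ σ≡ (y∈w , y≤w) P<y S<y with ∈-∃++ y∈w
... | a , b , refl = record
  { peak         = λ (u , v , σ≡′ , u<y , y>v) → peak (neighbours σ≡′) u<y y>v
  ; doubleAscent = λ (u , v , σ≡′ , u<y , y<v) → doubleAscent (neighbours σ≡′) u<y y<v
  ; valley       = λ (u , v , σ≡′ , u>y , y<v) → valley (neighbours σ≡′) u>y y<v
  }
  where
  y≤a : All (y ≤_) a
  y≤a = ++⁻ˡ a y≤w

  y≤b : All (y ≤_) b
  y≤b = All.tail (++⁻ʳ a y≤w)

  σ≡P++a++y∷b++S : σ ≡ (P ++ a) ++ y ∷ b ++ S
  σ≡P++a++y∷b++S = begin
    σ                            ≡⟨ σ≡ ⟩
    P ++ (a ++ y ∷ b) ++ S       ≡⟨ cong (P ++_) (++-assoc a (y ∷ b) S) ⟩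
    P ++ a ++ y ∷ b ++ S         ≡⟨ ++-assoc P a (y ∷ b ++ S) ⟨
    (P ++ a) ++ y ∷ b ++ S       ∎
    where open ≡-Reasoning

  neighbours : ∀ {u v} → σ ≡ u ++ y ∷ v → u ≡ P ++ a × v ≡ b ++ S
  neighbours σ≡′ with Unique-++-∷-cancel (P ++ a) (b ++ S)
                        (subst Unique σ≡P++a++y∷b++S uσ) (trans (sym σ≡P++a++y∷b++S) σ≡′)
  ... | refl , refl = refl , refl

  a≢[] : y < lastOr0 (P ++ a) → a ≢ []
  a≢[] y<last refl rewrite ++-identityʳ P = <-irrefl refl (<-trans y<last P<y)

  b≢[] : y < headOr0 (b ++ S) → b ≢ []
  b≢[] y<head refl = <-irrefl refl (<-trans y<head S<y)

  peak : ∀ {u v} → u ≡ P ++ a × v ≡ b ++ S → lastOr0 u < y → headOr0 v < y →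
         a ++ y ∷ b ≡ [ y ]
  peak (refl , refl) u<y v<y
    with lastOr0-++-<⇒≡[] P a y≤a u<y | headOr0-++-<⇒≡[] b S y≤b v<y
  ... | refl | refl = refl

  doubleAscent : ∀ {u v} → u ≡ P ++ a × v ≡ b ++ S → lastOr0 u < y → y < headOr0 v →
                 ∃[ w″ ] (w″ ≢ [] × a ++ y ∷ b ≡ y ∷ w″)
  doubleAscent (refl , refl) u<y y<v with lastOr0-++-<⇒≡[] P a y≤a u<y
  ... | refl = b , b≢[] y<v , refl

  valley : ∀ {u v} → u ≡ P ++ a × v ≡ b ++ S → y < lastOr0 u → y < headOr0 v →
           ∃[ w′ ] ∃[ w″ ] (w′ ≢ [] × w″ ≢ [] × a ++ y ∷ b ≡ w′ ++ y ∷ w″)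
  valley (refl , refl) y<u y<v = a , b , a≢[] y<u , b≢[] y<v , refl

w₂-min-shape : ∀ {σ x w₁ w₂ w₄ w₅ y} → Unique σ → XFactorization σ x w₁ w₂ w₄ w₅ →
               IsMin y w₂ → MinShape σ y w₂
w₂-min-shape {w₁ = w₁} {w₂} uσ (σ≡ , w₁<x , x<w₂ , _ , _) y-min@(y∈w₂ , _) =
  framed-min-shape w₁ w₂ _ uσ σ≡ y-min (LastLess⇒lastOr0< w₁ w₁<x x<y) x<y
  where
  x<y = All.lookup x<w₂ y∈w₂

w₄-min-shape : ∀ {σ x w₁ w₂ w₄ w₅ y} → Unique σ → XFactorization σ x w₁ w₂ w₄ w₅ →
               IsMin y w₄ → MinShape σ y w₄
w₄-min-shape {σ} {x} {w₁} {w₂} {w₄} {w₅} {y} uσ (σ≡ , _ , _ , x<w₄ , x>w₅) y-min@(y∈w₄ , _) =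
  framed-min-shape P w₄ w₅ uσ σ≡P++w₄++w₅ y-min P<y (FirstLess⇒headOr0< w₅ x>w₅ x<y)
  where
  x<y = All.lookup x<w₄ y∈w₄

  P = (w₁ ++ w₂) ++ [ x ]

  σ≡P++w₄++w₅ : σ ≡ P ++ w₄ ++ w₅
  σ≡P++w₄++w₅ = begin
    σ                               ≡⟨ σ≡ ⟩
    w₁ ++ w₂ ++ x ∷ w₄ ++ w₅        ≡⟨ ++-assoc w₁ w₂ (x ∷ w₄ ++ w₅) ⟨
    (w₁ ++ w₂) ++ x ∷ w₄ ++ w₅      ≡⟨ ++-assoc (w₁ ++ w₂) [ x ] (w₄ ++ w₅) ⟨
    P ++ w₄ ++ w₅                   ∎
    where open ≡-Reasoning

  P<y : lastOr0 P < y
  P<y rewrite lastOr0-++-[] (w₁ ++ w₂) x = x<y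

proposition2p6 : ∀ (n : ℕ) (σ : List ℕ) (x : ℕ) (w₁ w₂ w₄ w₅ : List ℕ) (y₁ y₂ : ℕ) →
    InG n σ → Valley σ x → XFactorization σ x w₁ w₂ w₄ w₅ →
    IsMin y₁ w₂ → IsMin y₂ w₄ →
    (Peak σ (y₁ ⊓ y₂) →
        (y₁ > y₂ → w₄ ≡ [ y₁ ⊓ y₂ ])
      × (y₁ < y₂ → w₂ ≡ [ y₁ ⊓ y₂ ]))
    × (DoubleAscent σ (y₁ ⊓ y₂) →
        (y₁ > y₂ → ∃[ w₄'' ] (w₄'' ≢ [] × w₄ ≡ (y₁ ⊓ y₂) ∷ w₄''))
      × (y₁ < y₂ → ∃[ w₂'' ] (w₂'' ≢ [] × w₂ ≡ (y₁ ⊓ y₂) ∷ w₂'')))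
    × (Valley σ (y₁ ⊓ y₂) →
        (y₁ > y₂ → ∃[ w₄' ] ∃[ w₄'' ] (w₄' ≢ [] × w₄'' ≢ [] × w₄ ≡ w₄' ++ (y₁ ⊓ y₂) ∷ w₄''))
      × (y₁ < y₂ → ∃[ w₂' ] ∃[ w₂'' ] (w₂' ≢ [] × w₂'' ≢ [] × w₂ ≡ w₂' ++ (y₁ ⊓ y₂) ∷ w₂'')))
proposition2p6 n σ x w₁ w₂ w₄ w₅ y₁ y₂ (σ↭ , _) _ xf y₁-min y₂-min =
    (λ p → (λ y₁>y₂ → peak (shape₄ y₁>y₂) p) , (λ y₁<y₂ → peak (shape₂ y₁<y₂) p))
  , (λ p → (λ y₁>y₂ → doubleAscent (shape₄ y₁>y₂) p) , (λ y₁<y₂ → doubleAscent (shape₂ y₁<y₂) p))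
  , (λ p → (λ y₁>y₂ → valley (shape₄ y₁>y₂) p) , (λ y₁<y₂ → valley (shape₂ y₁<y₂) p))
  where
  open MinShape
  uσ = IsPerm⇒Unique n σ↭

  shape₂ : y₁ < y₂ → MinShape σ (y₁ ⊓ y₂) w₂
  shape₂ y₁<y₂ = subst (λ y → MinShape σ y w₂) (sym (m≤n⇒m⊓n≡m (<⇒≤ y₁<y₂)))
                   (w₂-min-shape uσ xf y₁-min)

  shape₄ : y₁ > y₂ → MinShape σ (y₁ ⊓ y₂) w₄
  shape₄ y₁>y₂ = subst (λ y → MinShape σ y w₄) (sym (m≥n⇒m⊓n≡n (<⇒≤ y₁>y₂)))
                   (w₄-min-shape uσ xf y₂-min)
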